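{- For all integers $n\ge 2$ and $\kappa\ge 1$, a $\mathsf{PHF}(n;n\kappa,(n-1)\kappa+1,2n-1)$ exists.
   Context: A $\mathsf{PHF}(N;k,w,t)$ (perfect hash family) is an $N\times k$ array in which each row contains at most $w$ distinct symbols, such that for every set of $t$ columns there is a row in which the entries in these $t$ columns are pairwise distinct. -}

module Defs where

open import Data.Nat using (ℕ; _≤_)
open import Data.Fin using (Fin)
open import Data.List using (List; length)
open import Data.List.Membership.Propositional using (_∈_)
open import Data.Product using (Σ; _×_; ∃)
open import Relation.Binary.PropositionalEquality using (_≡_)

Array : ℕ → ℕ → Set
Array N k = Fin N → Fin k → ℕ

Injective : {A B : Set} → (A → B) → Set
Injective f = ∀ x y → f x ≡ f y → x ≡ y

-- Row r contains at most w distinct symbols: all entries of the row lie in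
-- some list of at most w symbols.
RowAtMost : {N k : ℕ} → Array N k → ℕ → Fin N → Set
RowAtMost {N} {k} A w r =
  Σ (List ℕ) λ S → (length S ≤ w) × (∀ (c : Fin k) → A r c ∈ S)

-- A set of t columns is given by an injective map Fin t → Fin k.
-- Row r separates it when the entries in those columns are pairwise distinct.
IsPHF : (N k w t : ℕ) → Array N k → Set
IsPHF N k w t A =
  (∀ (r : Fin N) → RowAtMost A w r) ×
  (∀ (cols : Fin t → Fin k) → Injective cols →
     ∃ λ (r : Fin N) → Injective (λ i → A r (cols i)))

PHFExists : (N k w t : ℕ) → Set
PHFExists N k w t = Σ (Array N k) (IsPHF N k w t)

-- Split the nκ columns into n blocks of κ and let row q be 0 on block q and
-- injective, with values in {1, …, (n−1)κ}, on the other columns; every row then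
-- has (n−1)κ + 1 symbols. Among 2n − 1 columns some block holds at most one of
-- them (otherwise 2n distinct columns would be chosen), and the row of that
-- block separates them.
module Submission where

open import Defs
open import Data.Nat using (ℕ; suc; _+_; _*_; _∸_; _≤_; _<_)
open import Data.Nat.Properties using (suc-injective; ≤-reflexive; +-comm; *-comm)
open import Data.Fin using (Fin; toℕ; combine; remQuot; punchOut) renaming (zero to fzero; suc to fsuc)
open import Data.Fin.Properties
  using (_≟_; any?; all?; ¬∀⟶∃¬; pigeonhole; <⇒≢; toℕ-injective; combine-injective; combine-remQuot; punchOut-injective)
open import Data.List using (List; _∷_; map; allFin; length)
open import Data.List.Properties using (length-map; length-tabulate)
open import Data.List.Membership.Propositional using (_∈_)
open import Data.List.Membership.Propositional.Properties using (∈-allFin; ∈-map⁺)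
open import Data.List.Relation.Unary.Any using (here; there)
open import Data.Product using (∃; _×_; _,_; proj₁; proj₂; uncurry)
open import Data.Empty using (⊥-elim)
open import Relation.Nullary using (¬_; Dec; yes; no; ¬?)
open import Relation.Nullary.Decidable using (_×-dec_)
open import Relation.Binary.PropositionalEquality using (_≡_; _≢_; refl; sym; trans; cong; module ≡-Reasoning)

remQuot-injective : ∀ {n} k (x y : Fin (n * k)) → remQuot {n} k x ≡ remQuot k y → x ≡ y
remQuot-injective {n} k x y eq = begin
  x                                 ≡⟨ sym (combine-remQuot {n} k x) ⟩
  uncurry combine (remQuot {n} k x) ≡⟨ cong (uncurry combine) eq ⟩
  uncurry combine (remQuot {n} k y) ≡⟨ combine-remQuot {n} k y ⟩
  y                                 ∎
  where open ≡-Reasoning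

AtMostOnePreimage : {m n : ℕ} → (Fin m → Fin n) → Fin n → Set
AtMostOnePreimage f r = ∀ i j → f i ≡ r → f j ≡ r → i ≡ j

TwoPreimages : {m n : ℕ} → (Fin m → Fin n) → Fin n → Set
TwoPreimages f r = ∃ λ i → ∃ λ j → i ≢ j × f i ≡ r × f j ≡ r

twoPreimages? : {m n : ℕ} (f : Fin m → Fin n) (r : Fin n) → Dec (TwoPreimages f r)
twoPreimages? f r = any? λ i → any? λ j → ¬? (i ≟ j) ×-dec (f i ≟ r) ×-dec (f j ≟ r)

¬twoPreimages⇒atMostOnePreimage : {m n : ℕ} (f : Fin m → Fin n) (r : Fin n) →
  ¬ TwoPreimages f r → AtMostOnePreimage f r
¬twoPreimages⇒atMostOnePreimage f r ¬two i j fi≡r fj≡r with i ≟ j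
... | yes i≡j = i≡j
... | no  i≢j = ⊥-elim (¬two (i , j , i≢j , fi≡r , fj≡r))

module _ {m n : ℕ} (f : Fin m → Fin n) (two : ∀ r → TwoPreimages f r) where

  preimage : Fin n × Fin 2 → Fin m
  preimage (r , fzero)      = proj₁ (two r)
  preimage (r , fsuc fzero) = proj₁ (proj₂ (two r))

  f∘preimage : ∀ p → f (preimage p) ≡ proj₁ p
  f∘preimage (r , fzero)      = proj₁ (proj₂ (proj₂ (proj₂ (two r))))
  f∘preimage (r , fsuc fzero) = proj₂ (proj₂ (proj₂ (proj₂ (two r))))

  preimage-injective : ∀ p q → preimage p ≡ preimage q → p ≡ q
  preimage-injective p q eq
    with trans (sym (f∘preimage p)) (trans (cong f eq) (f∘preimage q))
  preimage-injective (r , fzero)      (.r , fzero)      eq | refl = refl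
  preimage-injective (r , fzero)      (.r , fsuc fzero) eq | refl = ⊥-elim (proj₁ (proj₂ (proj₂ (two r))) eq)
  preimage-injective (r , fsuc fzero) (.r , fzero)      eq | refl = ⊥-elim (proj₁ (proj₂ (proj₂ (two r))) (sym eq))
  preimage-injective (r , fsuc fzero) (.r , fsuc fzero) eq | refl = refl

  doubleEmbedding : Fin (n * 2) → Fin m
  doubleEmbedding x = preimage (remQuot 2 x)

  doubleEmbedding-injective : Injective doubleEmbedding
  doubleEmbedding-injective x y eq =
    remQuot-injective 2 x y (preimage-injective (remQuot 2 x) (remQuot 2 y) eq)

∃-atMostOnePreimage : {m n : ℕ} → m < n * 2 → (f : Fin m → Fin n) → ∃ (AtMostOnePreimage f)
∃-atMostOnePreimage {m} {n} m<2n f with all? (twoPreimages? f)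
... | yes two =
  let (x , y , x<y , eq) = pigeonhole m<2n (doubleEmbedding f two)
  in ⊥-elim (<⇒≢ x<y (doubleEmbedding-injective f two x y eq))
... | no ¬two =
  let (r , ¬twoᵣ) = ¬∀⟶∃¬ n (TwoPreimages f) (twoPreimages? f) ¬two
  in r , ¬twoPreimages⇒atMostOnePreimage f r ¬twoᵣ

module BlockArray (n κ : ℕ) where

  block : Fin (suc n * κ) → Fin (suc n)
  block c = proj₁ (remQuot κ c)

  entry : Fin (suc n) → Fin (suc n) × Fin κ → ℕ
  entry r (q , s) with r ≟ q
  ... | yes _   = 0
  ... | no  r≢q = suc (toℕ (combine (punchOut r≢q) s))

  entry-injective : ∀ r p p′ → r ≢ proj₁ p → entry r p ≡ entry r p′ → p ≡ p′
  entry-injective r (q , s) (q′ , s′) r≢q eq with r ≟ q | r ≟ q′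
  ... | yes r≡q | _        = ⊥-elim (r≢q r≡q)
  ... | no  _   | yes _    with () ← eq
  ... | no  r≢q | no  r≢q′
    with combine-injective (punchOut r≢q) s (punchOut r≢q′) s′ (toℕ-injective (suc-injective eq))
  ... | po≡po′ , refl with refl ← punchOut-injective r≢q r≢q′ po≡po′ = refl

  symbols : List ℕ
  symbols = 0 ∷ map (λ x → suc (toℕ x)) (allFin (n * κ))

  array : Array (suc n) (suc n * κ)
  array r c = entry r (remQuot κ c)

  array-rowAtMost : ∀ r → RowAtMost array (n * κ + 1) r
  array-rowAtMost r = symbols , length-symbols , entry∈symbols
    where
    length-symbols : length symbols ≤ n * κ + 1
    length-symbols
      rewrite length-map (λ x → suc (toℕ x)) (allFin (n * κ)) | length-tabulate {n = n * κ} (λ x → x)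
      = ≤-reflexive (+-comm 1 (n * κ))

    entry∈symbols : ∀ c → array r c ∈ symbols
    entry∈symbols c with r ≟ block c
    ... | yes _ = here refl
    ... | no  _ = there (∈-map⁺ (λ x → suc (toℕ x)) (∈-allFin _))

  array-separates : ∀ {t} (cols : Fin t → Fin (suc n * κ)) → Injective cols →
    (r : Fin (suc n)) → AtMostOnePreimage (λ i → block (cols i)) r →
    Injective (λ i → array r (cols i))
  array-separates cols cols-inj r once i j eq = byBlock (r ≟ block (cols i)) (r ≟ block (cols j))
    where
    pᵢ pⱼ : Fin (suc n) × Fin κ
    pᵢ = remQuot κ (cols i)
    pⱼ = remQuot κ (cols j)

    byBlock : Dec (r ≡ proj₁ pᵢ) → Dec (r ≡ proj₁ pⱼ) → i ≡ j
    byBlock (yes r≡bᵢ) (yes r≡bⱼ) = once i j (sym r≡bᵢ) (sym r≡bⱼ)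
    byBlock (no  r≢bᵢ) _          =
      cols-inj i j (remQuot-injective κ (cols i) (cols j) (entry-injective r pᵢ pⱼ r≢bᵢ eq))
    byBlock (yes r≡bᵢ) (no  r≢bⱼ) =
      ⊥-elim (r≢bⱼ (trans r≡bᵢ (sym (cong proj₁ (entry-injective r pⱼ pᵢ r≢bⱼ (sym eq))))))

lemma19 : (n κ : ℕ) → 2 ≤ n → 1 ≤ κ →
    PHFExists n (n * κ) ((n ∸ 1) * κ + 1) (2 * n ∸ 1)
lemma19 (suc n) κ _ _ = array , array-rowAtMost , separates
  where
  open BlockArray n κ

  t<2n : 2 * suc n ∸ 1 < suc n * 2
  t<2n = ≤-reflexive (*-comm 2 (suc n))

  separates : ∀ cols → Injective cols → ∃ λ r → Injective (λ i → array r (cols i))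
  separates cols cols-inj =
    let (r , once) = ∃-atMostOnePreimage t<2n (λ i → block (cols i))
    in r , array-separates cols cols-inj r once
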